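{- For $n\geq 2$, $|\hat{\mathcal{B}}_n(312)|=2^{n-2}$.
   Context: An endofunction of size $n$ is a word $x=x_1\cdots x_n$ with entries in $\{1,\dots,n\}$; it is a Cayley permutation if it contains every integer between $1$ and $\max(x)$. Let $\mathrm{Ascbot}(x)=\{1\}\cup\{i:1\leq i\leq n-1,\ x_i<x_{i+1}\}$ and $\mathrm{Nub}(x)$ the set of indices $i$ such that $x_i$ is the leftmost occurrence of its value. A revised ascent sequence of length $n$ is a Cayley permutation $x$ of length $n$ with $\mathrm{Ascbot}(x)=\mathrm{Nub}(x)$. For Cayley permutations $x$ and $\sigma=\sigma_1\cdots\sigma_k$, $x$ contains $\sigma$ if there are indices $i_1<\cdots<i_k$ such that for all $s,t$: $x_{i_s}<x_{i_t}\iff\sigma_s<\sigma_t$ and $x_{i_s}=x_{i_t}\iff\sigma_s=\sigma_t$; otherwise $x$ avoids $\sigma$. $\hat{\mathcal{B}}_n(\sigma)$ is the set of revised ascent sequences of length $n$ avoiding $\sigma$. -}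

module Defs where

open import Data.Nat using (ℕ; zero; suc; _+_; _∸_; _<ᵇ_; _≡ᵇ_; _⊔_)
open import Data.Bool using (Bool; true; false; _∧_; _∨_; not; if_then_else_)
open import Data.List using (List; []; _∷_; map; filter; length; concatMap; foldr; take; drop; upTo)
open import Data.Bool.ListAction using (any; all)
open import Data.Product using (_×_; _,_)
open import Relation.Nullary.Decidable using (Dec)
open import Data.Bool.Properties using (T?)

-- Words are lists of natural numbers; positions are 1-based in the comments
-- but 0-based in the code.

_==_ : ℕ → ℕ → Bool
m == n = m ≡ᵇ n

elemᵇ : ℕ → List ℕ → Bool
elemᵇ v xs = any (λ y → v == y) xs

oneTo : ℕ → List ℕ
oneTo m = map suc (upTo m)

wordsOver : ℕ → ℕ → List (List ℕ)
wordsOver n zero    = [] ∷ []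
wordsOver n (suc k) = concatMap (λ v → map (v ∷_) (wordsOver n k)) (oneTo n)

endofunctions : ℕ → List (List ℕ)
endofunctions n = wordsOver n n

maxW : List ℕ → ℕ
maxW = foldr _⊔_ 0

isCayley : List ℕ → Bool
isCayley x = all (λ v → elemᵇ v x) (oneTo (maxW x))

-- i-th entry (0-based), defaulting to 0 out of range (never used out of range)
at : List ℕ → ℕ → ℕ
at []       _       = 0
at (y ∷ ys) zero    = y
at (y ∷ ys) (suc i) = at ys i

-- 1-based position p ∈ {1,…,n}
-- p ∈ Ascbot(x)  iff  p = 1  or  (p ≤ n-1 and x_p < x_{p+1})
inAscbot : List ℕ → ℕ → Bool
inAscbot x p = (p == 1) ∨ ((p <ᵇ length x) ∧ (at x (p ∸ 1) <ᵇ at x p))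

inNub : List ℕ → ℕ → Bool
inNub x p = not (elemᵇ (at x (p ∸ 1)) (take (p ∸ 1) x))

_⇔ᵇ_ : Bool → Bool → Bool
true  ⇔ᵇ b = b
false ⇔ᵇ b = not b

ascbotEqNub : List ℕ → Bool
ascbotEqNub x = all (λ p → inAscbot x p ⇔ᵇ inNub x p) (oneTo (length x))

isRevisedAscent : List ℕ → Bool
isRevisedAscent x = isCayley x ∧ ascbotEqNub x

subseqs : ℕ → List ℕ → List (List ℕ)
subseqs zero    _        = [] ∷ []
subseqs (suc k) []       = []
subseqs (suc k) (y ∷ ys) = map (y ∷_) (subseqs k ys) ++ subseqs (suc k) ys
  where
  open import Data.List using (_++_)

orderIso : List ℕ → List ℕ → Bool
orderIso a b =
  (length a == length b) ∧
  all (λ s → all (λ t →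
        ((at a s <ᵇ at a t) ⇔ᵇ (at b s <ᵇ at b t)) ∧
        ((at a s == at a t) ⇔ᵇ (at b s == at b t)))
      (upTo (length a)))
    (upTo (length a))

contains : List ℕ → List ℕ → Bool
contains x σ = any (λ ys → orderIso ys σ) (subseqs (length σ) x)

avoids : List ℕ → List ℕ → Bool
avoids x σ = not (contains x σ)

-- \hat{B}_n(σ): revised ascent sequences of length n avoiding σ
-- (listed among all endofunctions of size n, each word exactly once)
hatB : ℕ → List ℕ → List (List ℕ)
hatB n σ = filter (λ x → T? (isRevisedAscent x ∧ avoids x σ)) (endofunctions n)

p312 : List ℕ
p312 = 3 ∷ 1 ∷ 2 ∷ []

-- Scan a revised ascent sequence x avoiding 312 from left to right. Its first letter k is its
-- maximum (a larger letter would be new, hence followed by ever larger letters), and the letters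
-- read so far always form an interval [c, k]: a letter strictly between c and k completes a 312,
-- and jumping below c − 1 leaves c − 1 to be written later, again completing a 312. Together with
-- Ascbot = Nub this forces x = k^(1+a) ∏_{c = k−1, …, 1} c k^(1+i_c) c^(j_c), which an automaton
-- remembering only k and the current minimum c recognises. Summed over the first letter, the
-- numbers of accepted words of length 1 + l satisfy the recurrences of the even- and odd-sized
-- subsets of an l-set, so there are Σ_m C(n − 1, 2m) = 2^(n−2) of length n.

module Submission where

open import Defs

open import Algebra.Bundles using (CommutativeMonoid)
open import Data.Bool using (Bool; true; false; _∧_; _∨_; not; if_then_else_; T)
open import Data.Bool.ListAction using (any; all; or)
open import Data.Bool.Properties
  using (T-≡; T-∧; T-∨; ∧-zeroʳ; ∧-identityʳ; ∨-zeroʳ; ∨-identityʳ; ∧-assoc; ∨-assoc; ∧-distribʳ-∨;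
         ∨-commutativeMonoid; ∧-commutativeMonoid; ∨-∧-booleanAlgebra)
open import Data.Empty using (⊥-elim)
open import Data.List using (List; []; _∷_; _++_; [_]; map; filterᵇ; concatMap; upTo; applyUpTo; take; length)
open import Data.List.Properties using (++-assoc; ++-identityʳ; map-cong; map-cong-local; map-∘; length-++; filter-++)
open import Data.List.Relation.Unary.All using (All; []; _∷_)
import Data.List.Relation.Unary.All as All
import Data.List.Relation.Unary.All.Properties as All
open import Data.Nat using (ℕ; zero; suc; _+_; _^_; _∸_; _<ᵇ_; _≡ᵇ_; _⊔_; _≤_; _<_; z≤n; s≤s; z<s)
open import Data.Nat.ListAction using (sum)
open import Data.Nat.Properties
open import Data.Product using (_×_; _,_; proj₁)
open import Data.Sum using (_⊎_; inj₁; inj₂; [_,_]′)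
open import Data.Unit using (⊤)
open import Function using (_∘_; id)
open import Function.Bundles using (Equivalence; _⇔_; mk⇔)
open import Relation.Binary using (tri<; tri≈; tri>)
open import Relation.Binary.PropositionalEquality
  using (_≡_; _≢_; refl; sym; trans; cong; cong₂; subst; module ≡-Reasoning)
open import Relation.Nullary using (contradiction; yes; no)
open import Relation.Nullary.Decidable using (T?)

open import Algebra.Lattice.Properties.BooleanAlgebra ∨-∧-booleanAlgebra using (deMorgan₂)
open import Algebra.Properties.CommutativeSemigroup (CommutativeMonoid.commutativeSemigroup ∨-commutativeMonoid)
  using () renaming (interchange to ∨-interchange)
open import Algebra.Properties.CommutativeSemigroup +-commutativeSemigroup
  using () renaming (interchange to +-interchange)
open import Algebra.Solver.CommutativeMonoid ∧-commutativeMonoid using (_⊕_; _⊜_) renaming (solve to ∧-solve)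

<⇒<ᵇ≡true : ∀ {m n} → m < n → (m <ᵇ n) ≡ true
<⇒<ᵇ≡true m<n = Equivalence.to T-≡ (<⇒<ᵇ m<n)

<ᵇ≡true⇒< : ∀ {m n} → (m <ᵇ n) ≡ true → m < n
<ᵇ≡true⇒< {m} {n} eq = <ᵇ⇒< m n (Equivalence.from T-≡ eq)

≥⇒<ᵇ≡false : ∀ {m n} → n ≤ m → (m <ᵇ n) ≡ false
≥⇒<ᵇ≡false {m} {n} n≤m with m <ᵇ n in eq
... | false = refl
... | true  = contradiction n≤m (<⇒≱ (<ᵇ≡true⇒< eq))

<ᵇ≡false⇒≥ : ∀ {m n} → (m <ᵇ n) ≡ false → n ≤ m
<ᵇ≡false⇒≥ {m} {n} eq = ≮⇒≥ (λ m<n → contradiction (trans (sym eq) (<⇒<ᵇ≡true m<n)) λ ())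

≡ᵇ-refl : ∀ m → (m ≡ᵇ m) ≡ true
≡ᵇ-refl m = Equivalence.to T-≡ (≡⇒≡ᵇ m m refl)

≡ᵇ≡true⇒≡ : ∀ {m n} → (m ≡ᵇ n) ≡ true → m ≡ n
≡ᵇ≡true⇒≡ {m} {n} eq = ≡ᵇ⇒≡ m n (Equivalence.from T-≡ eq)

≢⇒≡ᵇ≡false : ∀ {m n} → m ≢ n → (m ≡ᵇ n) ≡ false
≢⇒≡ᵇ≡false {m} {n} m≢n with m ≡ᵇ n in eq
... | false = refl
... | true  = contradiction (≡ᵇ≡true⇒≡ eq) m≢n

T-injective : ∀ {x y} → T x ⇔ T y → x ≡ y
T-injective {false} {false} _   = refl
T-injective {false} {true}  x⇔y = ⊥-elim (Equivalence.from x⇔y _)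
T-injective {true}  {false} x⇔y = ⊥-elim (Equivalence.to x⇔y _)
T-injective {true}  {true}  _   = refl

⇔ᵇ-true : ∀ x → (x ⇔ᵇ true) ≡ x
⇔ᵇ-true false = refl
⇔ᵇ-true true  = refl

⇔ᵇ-false : ∀ x → (x ⇔ᵇ false) ≡ not x
⇔ᵇ-false false = refl
⇔ᵇ-false true  = refl

interval : ℕ → ℕ → List ℕ
interval j zero    = []
interval j (suc m) = j ∷ interval (suc j) m

oneTo≡interval : ∀ m → oneTo m ≡ interval 1 m
oneTo≡interval m = shifted 0 m
  where
  applyUpTo-cong : ∀ {f g : ℕ → ℕ} → (∀ i → f i ≡ g i) → ∀ m → applyUpTo f m ≡ applyUpTo g m
  applyUpTo-cong f≗g zero    = refl
  applyUpTo-cong f≗g (suc m) = cong₂ _∷_ (f≗g 0) (applyUpTo-cong (λ i → f≗g (suc i)) m)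
  shifted : ∀ j m → map suc (applyUpTo (j +_) m) ≡ interval (suc j) m
  shifted j zero    = refl
  shifted j (suc m) = cong₂ _∷_ (cong suc (+-identityʳ j))
    (trans (cong (map suc) (applyUpTo-cong (λ i → +-suc j i) m)) (shifted (suc j) m))

all-interval-true : ∀ (f : ℕ → Bool) j m → (∀ {y} → j ≤ y → y < j + m → f y ≡ true) →
                    all f (interval j m) ≡ true
all-interval-true f j zero    _ = refl
all-interval-true f j (suc m) h =
  cong₂ _∧_ (h ≤-refl (m<m+n j z<s))
            (all-interval-true f (suc j) m
               (λ {y} j<y y<j+m → h (<⇒≤ j<y) (subst (y <_) (sym (+-suc j m)) y<j+m)))

all-interval-false : ∀ (f : ℕ → Bool) {y} j m → j ≤ y → y < j + m → f y ≡ false →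
                     all f (interval j m) ≡ false
all-interval-false f {y} j zero    j≤y y<j+0 _ = contradiction (subst (y <_) (+-identityʳ j) y<j+0) (≤⇒≯ j≤y)
all-interval-false f {y} j (suc m) j≤y y<j+m fy with m≤n⇒m<n∨m≡n j≤y
... | inj₁ j<y  =
  trans (cong (f j ∧_) (all-interval-false f (suc j) m j<y (subst (y <_) (+-suc j m) y<j+m) fy)) (∧-zeroʳ (f j))
... | inj₂ refl = cong (_∧ all f (interval (suc j) m)) fy

-- The pattern 312

T-all-upTo3 : ∀ (f : ℕ → Bool) → T (all f (upTo 3)) → T (f 0) × T (f 1) × T (f 2)
T-all-upTo3 f p =
  let f₀ , f₁₂  = Equivalence.to T-∧ p
      f₁ , f₂tt = Equivalence.to T-∧ f₁₂
  in f₀ , f₁ , proj₁ (Equivalence.to T-∧ f₂tt)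

orderIso-312⇒ : ∀ a b c → T (orderIso (a ∷ b ∷ c ∷ []) p312) → T ((c <ᵇ a) ∧ (b <ᵇ c))
orderIso-312⇒ a b c iso =
  let _ , row₁ , row₂ = T-all-upTo3 (λ s → all (agree s) (upTo 3)) iso
      _ , _ , b<c     = T-all-upTo3 (agree 1) row₁
      c<a , _ , _     = T-all-upTo3 (agree 2) row₂
  in Equivalence.from T-∧ (lessFrom (c <ᵇ a) c<a , lessFrom (b <ᵇ c) b<c)
  where
  x = a ∷ b ∷ c ∷ []
  agree : ℕ → ℕ → Bool
  agree s t = ((at x s <ᵇ at x t) ⇔ᵇ (at p312 s <ᵇ at p312 t))
            ∧ ((at x s == at x t) ⇔ᵇ (at p312 s == at p312 t))
  lessFrom : ∀ u {v} → T ((u ⇔ᵇ true) ∧ v) → T u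
  lessFrom u p = subst T (⇔ᵇ-true u) (proj₁ (Equivalence.to T-∧ p))

orderIso-312⇐ : ∀ a b c → b < c → c < a → T (orderIso (a ∷ b ∷ c ∷ []) p312)
orderIso-312⇐ a b c b<c c<a with <-trans b<c c<a
... | b<a
  rewrite ≥⇒<ᵇ≡false (≤-refl {a}) | ≥⇒<ᵇ≡false (<⇒≤ b<a) | ≥⇒<ᵇ≡false (<⇒≤ c<a)
        | <⇒<ᵇ≡true b<a | ≥⇒<ᵇ≡false (≤-refl {b}) | <⇒<ᵇ≡true b<c
        | <⇒<ᵇ≡true c<a | ≥⇒<ᵇ≡false (<⇒≤ b<c) | ≥⇒<ᵇ≡false (≤-refl {c})
        | ≡ᵇ-refl a | ≡ᵇ-refl b | ≡ᵇ-refl c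
        | ≢⇒≡ᵇ≡false (>⇒≢ b<a) | ≢⇒≡ᵇ≡false (>⇒≢ c<a) | ≢⇒≡ᵇ≡false (<⇒≢ b<a)
        | ≢⇒≡ᵇ≡false (<⇒≢ b<c) | ≢⇒≡ᵇ≡false (<⇒≢ c<a) | ≢⇒≡ᵇ≡false (>⇒≢ b<c)
  = _

orderIso-312 : ∀ a b c → orderIso (a ∷ b ∷ c ∷ []) p312 ≡ ((c <ᵇ a) ∧ (b <ᵇ c))
orderIso-312 a b c = T-injective (mk⇔ (orderIso-312⇒ a b c) from)
  where
  from : T ((c <ᵇ a) ∧ (b <ᵇ c)) → T (orderIso (a ∷ b ∷ c ∷ []) p312)
  from p = let c<a , b<c = Equivalence.to T-∧ p
           in orderIso-312⇐ a b c (<ᵇ⇒< b c b<c) (<ᵇ⇒< c a c<a)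

any-++ : ∀ {A : Set} (p : A → Bool) xs ys → any p (xs ++ ys) ≡ any p xs ∨ any p ys
any-++ p []       ys = refl
any-++ p (x ∷ xs) ys = trans (cong (p x ∨_) (any-++ p xs ys)) (sym (∨-assoc (p x) _ _))

any-snoc : ∀ {A : Set} (p : A → Bool) xs y → any p (xs ++ [ y ]) ≡ any p xs ∨ p y
any-snoc p xs y = trans (any-++ p xs [ y ]) (cong (any p xs ∨_) (∨-identityʳ (p y)))

any-subseqs-∷ : ∀ (p : List ℕ → Bool) k y ys →
  any p (subseqs (suc k) (y ∷ ys)) ≡ any (λ t → p (y ∷ t)) (subseqs k ys) ∨ any p (subseqs (suc k) ys)
any-subseqs-∷ p k y ys =
  trans (any-++ p (map (y ∷_) (subseqs k ys)) _) (cong (λ b → or b ∨ _) (sym (map-∘ (subseqs k ys))))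

has12Below : ℕ → List ℕ → Bool
has12Below a []       = false
has12Below a (b ∷ bs) = any (λ c → (c <ᵇ a) ∧ (b <ᵇ c)) bs ∨ has12Below a bs

has312 : List ℕ → Bool
has312 []       = false
has312 (a ∷ as) = has12Below a as ∨ has312 as

contains-312 : ∀ x → contains x p312 ≡ has312 x
contains-312 []       = refl
contains-312 (a ∷ as) = trans (any-subseqs-∷ _ 2 a as) (cong₂ _∨_ (below as) (contains-312 as))
  where
  below : ∀ bs → any (λ t → orderIso (a ∷ t) p312) (subseqs 2 bs) ≡ has12Below a bs
  below []       = refl
  below (b ∷ bs) = trans (any-subseqs-∷ _ 1 b bs) (cong₂ _∨_ (above bs) (below bs))
    where
    above : ∀ cs → any (λ t → orderIso (a ∷ b ∷ t) p312) (subseqs 1 cs)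
                   ≡ any (λ c → (c <ᵇ a) ∧ (b <ᵇ c)) cs
    above []       = refl
    above (c ∷ cs) = cong₂ _∨_ (orderIso-312 a b c) (above cs)

completes312 : List ℕ → ℕ → Bool
completes312 []       z = false
completes312 (a ∷ as) z = any (λ b → (z <ᵇ a) ∧ (b <ᵇ z)) as ∨ completes312 as z

has12Below-snoc : ∀ a bs z →
  has12Below a (bs ++ [ z ]) ≡ has12Below a bs ∨ any (λ b → (z <ᵇ a) ∧ (b <ᵇ z)) bs
has12Below-snoc a []       z = refl
has12Below-snoc a (b ∷ bs) z =
  trans (cong₂ _∨_ (any-snoc _ bs z) (has12Below-snoc a bs z))
        (∨-interchange (any (λ c → (c <ᵇ a) ∧ (b <ᵇ c)) bs) _ (has12Below a bs) _)

has312-snoc : ∀ pre z → has312 (pre ++ [ z ]) ≡ has312 pre ∨ completes312 pre z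
has312-snoc []       z = refl
has312-snoc (a ∷ as) z =
  trans (cong₂ _∨_ (has12Below-snoc a as z) (has312-snoc as z))
        (∨-interchange (has12Below a as) _ (has312 as) _)

<ᵇ-⊔ : ∀ z a b → (z <ᵇ a ⊔ b) ≡ (z <ᵇ a) ∨ (z <ᵇ b)
<ᵇ-⊔ z a b with ≤-total a b
... | inj₁ a≤b rewrite m≤n⇒m⊔n≡n a≤b with z <ᵇ a in z<a
...   | true  = <⇒<ᵇ≡true (<-≤-trans (<ᵇ≡true⇒< z<a) a≤b)
...   | false = refl
<ᵇ-⊔ z a b | inj₂ b≤a rewrite m≥n⇒m⊔n≡m b≤a with z <ᵇ a in z<a
...   | true  = refl
...   | false = sym (≥⇒<ᵇ≡false (≤-trans b≤a (<ᵇ≡false⇒≥ z<a)))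

completes312-snoc : ∀ pre y z →
  completes312 (pre ++ [ y ]) z ≡ completes312 pre z ∨ ((z <ᵇ maxW pre) ∧ (y <ᵇ z))
completes312-snoc []       y z = refl
completes312-snoc (a ∷ as) y z = begin
    any below (as ++ [ y ]) ∨ completes312 (as ++ [ y ]) z
  ≡⟨ cong₂ _∨_ (any-snoc below as y) (completes312-snoc as y z) ⟩
    (any below as ∨ ((z <ᵇ a) ∧ (y <ᵇ z))) ∨ (completes312 as z ∨ ((z <ᵇ maxW as) ∧ (y <ᵇ z)))
  ≡⟨ ∨-interchange (any below as) _ (completes312 as z) _ ⟩
    completes312 (a ∷ as) z ∨ (((z <ᵇ a) ∧ (y <ᵇ z)) ∨ ((z <ᵇ maxW as) ∧ (y <ᵇ z)))
  ≡⟨ cong (completes312 (a ∷ as) z ∨_) (sym (∧-distribʳ-∨ (y <ᵇ z) (z <ᵇ a) _)) ⟩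
    completes312 (a ∷ as) z ∨ (((z <ᵇ a) ∨ (z <ᵇ maxW as)) ∧ (y <ᵇ z))
  ≡⟨ cong (λ u → completes312 (a ∷ as) z ∨ (u ∧ (y <ᵇ z))) (sym (<ᵇ-⊔ z a (maxW as))) ⟩
    completes312 (a ∷ as) z ∨ ((z <ᵇ maxW (a ∷ as)) ∧ (y <ᵇ z)) ∎
  where
  open ≡-Reasoning
  below = λ b → (z <ᵇ a) ∧ (b <ᵇ z)

completes312-snoc-old : ∀ {y} pre z → completes312 pre y ≡ true → completes312 (pre ++ [ z ]) y ≡ true
completes312-snoc-old {y} pre z yc = trans (completes312-snoc pre z y) (cong (_∨ ((y <ᵇ maxW pre) ∧ (z <ᵇ y))) yc)

completes312-snoc-new : ∀ {y} pre z → y < maxW pre → z < y → completes312 (pre ++ [ z ]) y ≡ true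
completes312-snoc-new {y} pre z y<max z<y =
  trans (completes312-snoc pre z y)
        (trans (cong₂ (λ u v → completes312 pre y ∨ (u ∧ v)) (<⇒<ᵇ≡true y<max) (<⇒<ᵇ≡true z<y)) (∨-zeroʳ _))

completes312-snoc⁻ : ∀ {y} pre z → completes312 (pre ++ [ z ]) y ≡ true →
                     completes312 pre y ≡ true ⊎ (y < maxW pre × z < y)
completes312-snoc⁻ {y} pre z yc =
  [ inj₁ ∘ Equivalence.to T-≡
  , (λ both → let y<max , z<y = Equivalence.to T-∧ both in inj₂ (<ᵇ⇒< _ _ y<max , <ᵇ⇒< _ _ z<y)) ]′
  (Equivalence.to T-∨ (Equivalence.from T-≡ (trans (sym (completes312-snoc pre z y)) yc)))

-- Ascent bottoms and first occurrences

isAscentBottom : ℕ → List ℕ → Bool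
isAscentBottom z []      = false
isAscentBottom z (w ∷ _) = z <ᵇ w

ascentIffNew : List ℕ → ℕ → List ℕ → Bool
ascentIffNew pre z zs = isAscentBottom z zs ⇔ᵇ not (elemᵇ z pre)

ascbotEqNubAfter : List ℕ → List ℕ → Bool
ascbotEqNubAfter pre []       = true
ascbotEqNubAfter pre (z ∷ zs) = ascentIffNew pre z zs ∧ ascbotEqNubAfter (pre ++ [ z ]) zs

positionOk : List ℕ → ℕ → Bool
positionOk x p = inAscbot x p ⇔ᵇ inNub x p

positionOk-after : ∀ a as z zs →
  positionOk (a ∷ as ++ z ∷ zs) (2 + length as) ≡ ascentIffNew (a ∷ as) z zs
positionOk-after a as z zs =
  cong₂ _⇔ᵇ_ (ascbot as zs)
             (cong₂ (λ w ws → not (elemᵇ w ws)) (at-after as) (cong (a ∷_) (take-after as)))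
  where
  ascbot : ∀ as zs → ((suc (length as) <ᵇ length (as ++ z ∷ zs))
                   ∧ (at (as ++ z ∷ zs) (length as) <ᵇ at (as ++ z ∷ zs) (suc (length as))))
                  ≡ isAscentBottom z zs
  ascbot []       []      = refl
  ascbot []       (_ ∷ _) = refl
  ascbot (_ ∷ bs) zs      = ascbot bs zs
  at-after : ∀ as → at (as ++ z ∷ zs) (length as) ≡ z
  at-after []       = refl
  at-after (_ ∷ bs) = at-after bs
  take-after : ∀ as → take (length as) (as ++ z ∷ zs) ≡ as
  take-after []       = refl
  take-after (b ∷ bs) = cong (b ∷_) (take-after bs)

ascbotEqNubAfter-correct : ∀ {x} a as ys → x ≡ a ∷ as ++ ys →
  all (positionOk x) (interval (2 + length as) (length ys)) ≡ ascbotEqNubAfter (a ∷ as) ys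
ascbotEqNubAfter-correct a as []       _    = refl
ascbotEqNubAfter-correct a as (y ∷ ys) refl = cong₂ _∧_ (positionOk-after a as y ys) (begin
    all (positionOk x) (interval (3 + length as) (length ys))
  ≡⟨ cong (λ l → all (positionOk x) (interval (2 + l) (length ys)))
          (sym (trans (length-++ as) (+-comm (length as) 1))) ⟩
    all (positionOk x) (interval (2 + length (as ++ [ y ])) (length ys))
  ≡⟨ ascbotEqNubAfter-correct a (as ++ [ y ]) ys (cong (a ∷_) (sym (++-assoc as [ y ] ys))) ⟩
    ascbotEqNubAfter (a ∷ as ++ [ y ]) ys ∎)
  where
  open ≡-Reasoning
  x = a ∷ as ++ y ∷ ys

ascbotEqNub-∷ : ∀ v xs → ascbotEqNub (v ∷ xs) ≡ ascbotEqNubAfter [ v ] xs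
ascbotEqNub-∷ v xs = trans (cong (all (positionOk (v ∷ xs))) (oneTo≡interval (suc (length xs))))
                           (ascbotEqNubAfter-correct v [] xs refl)

-- Scanning a word from left to right

validAfter : List ℕ → List ℕ → Bool
validAfter pre []       = isCayley pre
validAfter pre (z ∷ zs) = ascentIffNew pre z zs ∧ (not (completes312 pre z) ∧ validAfter (pre ++ [ z ]) zs)

validAfter-correct : ∀ pre zs → validAfter pre zs ∧ not (has312 pre)
                     ≡ isCayley (pre ++ zs) ∧ (ascbotEqNubAfter pre zs ∧ not (has312 (pre ++ zs)))
validAfter-correct pre [] rewrite ++-identityʳ pre = refl
validAfter-correct pre (z ∷ zs) = begin
    (a ∧ (not b ∧ r)) ∧ not h
  ≡⟨ ∧-solve 4 (λ a b r h → (a ⊕ (b ⊕ r)) ⊕ h ⊜ a ⊕ (r ⊕ (h ⊕ b))) refl a (not b) r (not h) ⟩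
    a ∧ (r ∧ (not h ∧ not b))
  ≡⟨ cong (λ u → a ∧ (r ∧ u)) (trans (sym (deMorgan₂ h b)) (cong not (sym (has312-snoc pre z)))) ⟩
    a ∧ (r ∧ not (has312 (pre ++ [ z ])))
  ≡⟨ cong (a ∧_) (validAfter-correct (pre ++ [ z ]) zs) ⟩
    a ∧ (isCayley ((pre ++ [ z ]) ++ zs) ∧ (e ∧ not (has312 ((pre ++ [ z ]) ++ zs))))
  ≡⟨ cong (λ w → a ∧ (isCayley w ∧ (e ∧ not (has312 w)))) (++-assoc pre [ z ] zs) ⟩
    a ∧ (isCayley w ∧ (e ∧ not (has312 w)))
  ≡⟨ ∧-solve 4 (λ a c e h → a ⊕ (c ⊕ (e ⊕ h)) ⊜ c ⊕ ((a ⊕ e) ⊕ h)) refl a (isCayley w) e (not (has312 w)) ⟩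
    isCayley w ∧ ((a ∧ e) ∧ not (has312 w)) ∎
  where
  open ≡-Reasoning
  a = ascentIffNew pre z zs
  b = completes312 pre z
  h = has312 pre
  r = validAfter (pre ++ [ z ]) zs
  e = ascbotEqNubAfter (pre ++ [ z ]) zs
  w = pre ++ z ∷ zs

revisedAvoiding312≡validAfter : ∀ v xs →
  isRevisedAscent (v ∷ xs) ∧ avoids (v ∷ xs) p312 ≡ validAfter [ v ] xs
revisedAvoiding312≡validAfter v xs = begin
    (isCayley x ∧ ascbotEqNub x) ∧ not (contains x p312)
  ≡⟨ cong₂ (λ e h → (isCayley x ∧ e) ∧ not h) (ascbotEqNub-∷ v xs) (contains-312 x) ⟩
    (isCayley x ∧ ascbotEqNubAfter [ v ] xs) ∧ not (has312 x)
  ≡⟨ ∧-assoc (isCayley x) _ _ ⟩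
    isCayley x ∧ (ascbotEqNubAfter [ v ] xs ∧ not (has312 x))
  ≡⟨ sym (validAfter-correct [ v ] xs) ⟩
    validAfter [ v ] xs ∧ true
  ≡⟨ ∧-identityʳ _ ⟩
    validAfter [ v ] xs ∎
  where
  open ≡-Reasoning
  x = v ∷ xs

elemᵇ-snoc : ∀ y pre z → elemᵇ y (pre ++ [ z ]) ≡ elemᵇ y pre ∨ (y ≡ᵇ z)
elemᵇ-snoc y = any-snoc (y ==_)

elemᵇ-snoc-old : ∀ {y} pre z → elemᵇ y pre ≡ true → elemᵇ y (pre ++ [ z ]) ≡ true
elemᵇ-snoc-old {y} pre z y∈ = trans (elemᵇ-snoc y pre z) (cong (_∨ (y ≡ᵇ z)) y∈)

elemᵇ-snoc-last : ∀ pre z → elemᵇ z (pre ++ [ z ]) ≡ true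
elemᵇ-snoc-last pre z = trans (elemᵇ-snoc z pre z) (trans (cong (elemᵇ z pre ∨_) (≡ᵇ-refl z)) (∨-zeroʳ _))

elemᵇ-snoc-absent : ∀ {y} pre z → elemᵇ y pre ≡ false → y ≢ z → elemᵇ y (pre ++ [ z ]) ≡ false
elemᵇ-snoc-absent {y} pre z y∉ y≢z = trans (elemᵇ-snoc y pre z) (cong₂ _∨_ y∉ (≢⇒≡ᵇ≡false y≢z))

elemᵇ-snoc⁻ : ∀ {y} pre z → elemᵇ y (pre ++ [ z ]) ≡ true → elemᵇ y pre ≡ true ⊎ y ≡ z
elemᵇ-snoc⁻ {y} pre z y∈ =
  [ inj₁ ∘ Equivalence.to T-≡ , inj₂ ∘ ≡ᵇ⇒≡ y z ]′
  (Equivalence.to T-∨ (Equivalence.from T-≡ (trans (sym (elemᵇ-snoc y pre z)) y∈)))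

maxW-snoc : ∀ pre z → maxW (pre ++ [ z ]) ≡ maxW pre ⊔ z
maxW-snoc []       z = ⊔-identityʳ z
maxW-snoc (a ∷ as) z = trans (cong (a ⊔_) (maxW-snoc as z)) (sym (⊔-assoc a (maxW as) z))

elemᵇ-above-maxW : ∀ pre {z} → maxW pre < z → elemᵇ z pre ≡ false
elemᵇ-above-maxW []       _ = refl
elemᵇ-above-maxW (a ∷ as) {z} max<z =
  cong₂ _∨_ (≢⇒≡ᵇ≡false (>⇒≢ (≤-<-trans (m≤m⊔n a (maxW as)) max<z)))
            (elemᵇ-above-maxW as (≤-<-trans (m≤n⊔m a (maxW as)) max<z))

completes312-above-maxW : ∀ pre {z} → maxW pre ≤ z → completes312 pre z ≡ false
completes312-above-maxW []       _ = refl
completes312-above-maxW (a ∷ as) {z} max≤z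
  rewrite ≥⇒<ᵇ≡false (≤-trans (m≤m⊔n a (maxW as)) max≤z)
  = cong₂ _∨_ (none as) (completes312-above-maxW as (≤-trans (m≤n⊔m a (maxW as)) max≤z))
  where
  none : ∀ bs → any (λ _ → false) bs ≡ false
  none []       = refl
  none (_ ∷ bs) = none bs

record Prefix (pre : List ℕ) (k c : ℕ) : Set where
  field
    1≤c        : 1 ≤ c
    c≤k        : c ≤ k
    maxW≡k     : maxW pre ≡ k
    ∈⁺         : ∀ {z} → c ≤ z → z ≤ k → elemᵇ z pre ≡ true
    ∈⁻         : ∀ {z} → elemᵇ z pre ≡ true → c ≤ z × z ≤ k
    completes⁺ : ∀ {z} → c < z → z < k → completes312 pre z ≡ true
    completes⁻ : ∀ {z} → completes312 pre z ≡ true → c < z × z < k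

  ∉ : ∀ {z} → z < c → elemᵇ z pre ≡ false
  ∉ {z} z<c with elemᵇ z pre in z∈pre
  ... | false = refl
  ... | true  = contradiction (proj₁ (∈⁻ z∈pre)) (<⇒≱ z<c)

  ¬completes : ∀ {z} → z ≤ c ⊎ k ≤ z → completes312 pre z ≡ false
  ¬completes {z} outside with completes312 pre z in completes
  ... | false = refl
  ... | true  with completes⁻ completes | outside
  ...   | c<z , _ | inj₁ z≤c = contradiction z≤c (<⇒≱ c<z)
  ...   | _ , z<k | inj₂ k≤z = contradiction k≤z (<⇒≱ z<k)

open Prefix

Prefix-[] : ∀ {v} → 1 ≤ v → Prefix [ v ] v v
Prefix-[] {v} 1≤v = record
  { 1≤c = 1≤v ; c≤k = ≤-refl ; maxW≡k = ⊔-identityʳ v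
  ; ∈⁺ = λ v≤z z≤v → cong (_∨ false) (subst (λ z → (z ≡ᵇ v) ≡ true) (≤-antisym v≤z z≤v) (≡ᵇ-refl v))
  ; ∈⁻ = λ z∈ → let z≡v = ≡ᵇ≡true⇒≡ (trans (sym (∨-identityʳ _)) z∈) in ≤-reflexive (sym z≡v) , ≤-reflexive z≡v
  ; completes⁺ = λ v<z z<v → contradiction (<-trans v<z z<v) (<-irrefl refl)
  ; completes⁻ = λ ()
  }

Prefix-snoc-old : ∀ {pre k c z} → Prefix pre k c → z ≡ k ⊎ z ≡ c → Prefix (pre ++ [ z ]) k c
Prefix-snoc-old {pre} {k} {c} {z} P old = record
  { 1≤c = 1≤c P ; c≤k = c≤k P
  ; maxW≡k = trans (maxW-snoc pre z) (trans (cong (_⊔ z) (maxW≡k P)) (m≥n⇒m⊔n≡m z≤k))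
  ; ∈⁺ = λ {y} c≤y y≤k → elemᵇ-snoc-old {y} pre z (∈⁺ P c≤y y≤k)
  ; ∈⁻ = λ {y} y∈ → [ ∈⁻ P , (λ { refl → c≤z , z≤k }) ]′ (elemᵇ-snoc⁻ {y} pre z y∈)
  ; completes⁺ = λ {y} c<y y<k → completes312-snoc-old {y} pre z (completes⁺ P c<y y<k)
  ; completes⁻ = λ {y} yc → [ completes⁻ P , (λ (y<max , z<y) → ≤-<-trans c≤z z<y , below-k y<max) ]′
                          (completes312-snoc⁻ {y} pre z yc)
  }
  where
  z≤k : z ≤ k
  z≤k = [ ≤-reflexive , (λ z≡c → subst (_≤ k) (sym z≡c) (c≤k P)) ]′ old
  c≤z : c ≤ z
  c≤z = [ (λ z≡k → subst (c ≤_) (sym z≡k) (c≤k P)) , (λ z≡c → ≤-reflexive (sym z≡c)) ]′ old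
  below-k : ∀ {y} → y < maxW pre → y < k
  below-k {y} = subst (y <_) (maxW≡k P)

Prefix-snoc-newMin : ∀ {pre k c z} → Prefix pre k c → 1 ≤ z → suc z ≡ c → Prefix (pre ++ [ z ]) k z
Prefix-snoc-newMin {pre} {k} {c} {z} P 1≤z refl = record
  { 1≤c = 1≤z ; c≤k = <⇒≤ z<k
  ; maxW≡k = trans (maxW-snoc pre z) (trans (cong (_⊔ z) (maxW≡k P)) (m≥n⇒m⊔n≡m (<⇒≤ z<k)))
  ; ∈⁺ = ∈⁺′
  ; ∈⁻ = λ {y} y∈ → [ (λ y∈pre → let c≤y , y≤k = ∈⁻ P y∈pre in <⇒≤ c≤y , y≤k)
                    , (λ { refl → ≤-refl , <⇒≤ z<k }) ]′
                   (elemᵇ-snoc⁻ {y} pre z y∈)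
  ; completes⁺ = λ {y} z<y y<k → completes312-snoc-new pre z (subst (y <_) (sym (maxW≡k P)) y<k) z<y
  ; completes⁻ = λ {y} yc → [ (λ yc-pre → let c<y , y<k = completes⁻ P yc-pre in <-trans (n<1+n z) c<y , y<k)
                          , (λ (y<max , z<y) → z<y , subst (y <_) (maxW≡k P) y<max) ]′
                          (completes312-snoc⁻ {y} pre z yc)
  }
  where
  z<k : z < k
  z<k = <-≤-trans (n<1+n z) (c≤k P)
  ∈⁺′ : ∀ {y} → z ≤ y → y ≤ k → elemᵇ y (pre ++ [ z ]) ≡ true
  ∈⁺′ {y} z≤y y≤k with m≤n⇒m<n∨m≡n z≤y
  ... | inj₁ z<y  = elemᵇ-snoc-old {y} pre z (∈⁺ P z<y y≤k)
  ... | inj₂ refl = elemᵇ-snoc-last pre z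

isCayley-Prefix : ∀ {pre k c} → Prefix pre k c → isCayley pre ≡ (c ≡ᵇ 1)
isCayley-Prefix {pre} {k} {c} P = begin
    all (λ v → elemᵇ v pre) (oneTo (maxW pre))
  ≡⟨ cong (λ m → all (λ v → elemᵇ v pre) m) (trans (cong oneTo (maxW≡k P)) (oneTo≡interval k)) ⟩
    all (λ v → elemᵇ v pre) (interval 1 k)
  ≡⟨ onlyIfFrom1 c (1≤c P) (c≤k P) (∈⁺ P) (∉ P) ⟩
    (c ≡ᵇ 1) ∎
  where
  open ≡-Reasoning
  onlyIfFrom1 : ∀ c → 1 ≤ c → c ≤ k → (∀ {z} → c ≤ z → z ≤ k → elemᵇ z pre ≡ true) →
                (∀ {z} → z < c → elemᵇ z pre ≡ false) →
                all (λ v → elemᵇ v pre) (interval 1 k) ≡ (c ≡ᵇ 1)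
  onlyIfFrom1 1             _ _   present _      =
    all-interval-true _ 1 k (λ 1≤y y<1+k → present 1≤y (≤-pred y<1+k))
  onlyIfFrom1 (suc (suc c)) _ c≤k _       absent =
    all-interval-false _ 1 k ≤-refl (s≤s (≤-trans (s≤s z≤n) c≤k)) (absent (s≤s (s≤s z≤n)))

validAfter-old : ∀ {pre k c z} zs → Prefix pre k c → z ≡ k ⊎ z ≡ c →
                 validAfter pre (z ∷ zs) ≡ not (isAscentBottom z zs) ∧ validAfter (pre ++ [ z ]) zs
validAfter-old {pre} {z = z} zs P (inj₁ refl) rewrite ∈⁺ P (c≤k P) ≤-refl | ¬completes P (inj₂ ≤-refl) =
  cong (_∧ validAfter (pre ++ [ z ]) zs) (⇔ᵇ-false (isAscentBottom z zs))
validAfter-old {pre} {z = z} zs P (inj₂ refl) rewrite ∈⁺ P ≤-refl (c≤k P) | ¬completes P (inj₁ ≤-refl) =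
  cong (_∧ validAfter (pre ++ [ z ]) zs) (⇔ᵇ-false (isAscentBottom z zs))

validAfter-newMin : ∀ {pre k c z} zs → Prefix pre k c → suc z ≡ c →
                    validAfter pre (z ∷ zs) ≡ isAscentBottom z zs ∧ validAfter (pre ++ [ z ]) zs
validAfter-newMin {pre} {z = z} zs P refl rewrite ∉ P ≤-refl | ¬completes P (inj₁ (n≤1+n z)) =
  cong (_∧ validAfter (pre ++ [ z ]) zs) (⇔ᵇ-true (isAscentBottom z zs))

validAfter-completes312 : ∀ {pre z} zs → completes312 pre z ≡ true → validAfter pre (z ∷ zs) ≡ false
validAfter-completes312 {pre} {z} zs completes rewrite completes = ∧-zeroʳ (ascentIffNew pre z zs)

validAfter-rest-false : ∀ {pre z} zs → validAfter (pre ++ [ z ]) zs ≡ false →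
                        validAfter pre (z ∷ zs) ≡ false
validAfter-rest-false {pre} {z} zs rest rewrite rest =
  trans (cong (ascentIffNew pre z zs ∧_) (∧-zeroʳ (not (completes312 pre z)))) (∧-zeroʳ (ascentIffNew pre z zs))

-- A letter above every earlier one is new, so it must be followed by an even larger letter, forever.
validAfter-newMax : ∀ pre {z} zs → maxW pre < z → validAfter pre (z ∷ zs) ≡ false
validAfter-newMax pre {z} zs max<z
  rewrite elemᵇ-above-maxW pre max<z | completes312-above-maxW pre (<⇒≤ max<z) with zs
... | []     = refl
... | w ∷ ws with z <ᵇ w in z<w
...   | false = refl
...   | true  = validAfter-newMax (pre ++ [ z ]) ws
                  (subst (_< w) (sym (trans (maxW-snoc pre z) (m≤n⇒m⊔n≡n (<⇒≤ max<z)))) (<ᵇ≡true⇒< z<w))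

-- A missing value y that would complete a 312 can never be written, so the word is not Cayley.
validAfter-gap : ∀ {pre y} zs → 1 ≤ y → y ≤ maxW pre → elemᵇ y pre ≡ false → completes312 pre y ≡ true →
                 validAfter pre zs ≡ false
validAfter-gap {pre} {y} [] 1≤y y≤max y∉pre _ =
  trans (cong (all (λ v → elemᵇ v pre)) (oneTo≡interval (maxW pre)))
        (all-interval-false _ 1 (maxW pre) 1≤y (s≤s y≤max) y∉pre)
validAfter-gap {pre} {y} (z ∷ zs) 1≤y y≤max y∉pre yc with z ≟ y
... | yes refl = validAfter-completes312 zs yc
... | no z≢y   = validAfter-rest-false zs rest
  where
  rest : validAfter (pre ++ [ z ]) zs ≡ false
  rest = validAfter-gap zs 1≤y
    (subst (y ≤_) (sym (maxW-snoc pre z)) (≤-trans y≤max (m≤m⊔n (maxW pre) z)))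
    (elemᵇ-snoc-absent pre z y∉pre (z≢y ∘ sym))
    (completes312-snoc-old pre z yc)

validAfter-reject : ∀ {pre k c z} zs → Prefix pre k c → 1 ≤ z → z ≢ k → z ≢ c → suc z ≢ c →
                    validAfter pre (z ∷ zs) ≡ false
validAfter-reject {pre} {k} {c} {z} zs P 1≤z z≢k z≢c 1+z≢c with <-cmp z c
... | tri≈ _ z≡c _ = contradiction z≡c z≢c
... | tri< z<c _ _ = skipsValue P (≤∧≢⇒< z<c 1+z≢c)
  where
  skipsValue : ∀ {c} → Prefix pre k c → suc z < c → validAfter pre (z ∷ zs) ≡ false
  skipsValue {suc y} P 1+z<1+y = validAfter-rest-false zs rest
    where
    z<y = ≤-pred 1+z<1+y
    y<max : y < maxW pre
    y<max = subst (y <_) (sym (maxW≡k P)) (<-≤-trans ≤-refl (c≤k P))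
    rest : validAfter (pre ++ [ z ]) zs ≡ false
    rest = validAfter-gap zs (≤-trans 1≤z (<⇒≤ z<y))
      (subst (y ≤_) (sym (maxW-snoc pre z)) (≤-trans (<⇒≤ y<max) (m≤m⊔n (maxW pre) z)))
      (elemᵇ-snoc-absent pre z (∉ P ≤-refl) (>⇒≢ z<y))
      (completes312-snoc-new pre z y<max z<y)
... | tri> _ _ c<z with <-cmp z k
...   | tri< z<k _ _ = validAfter-completes312 zs (completes⁺ P c<z z<k)
...   | tri≈ _ z≡k _ = contradiction z≡k z≢k
...   | tri> _ _ k<z = validAfter-newMax pre zs (subst (_< z) (sym (maxW≡k P)) k<z)

-- The automaton

-- The position of the scan in the shape k^(1+a) ∏ c k^(1+i) c^j: in the leading k's, just after
-- a new minimum c, in the k's that follow it, or in the c's after those.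
data Phase : Set where
  maxOnly afterNewMin afterMax afterMin dead : Phase

data Letter : Set where
  maximum minimum nextMinimum : Letter

step : Phase → Letter → Phase
step maxOnly     maximum     = maxOnly
step maxOnly     nextMinimum = afterNewMin
step afterNewMin maximum     = afterMax
step afterMax    maximum     = afterMax
step afterMax    minimum     = afterMin
step afterMax    nextMinimum = afterNewMin
step afterMin    minimum     = afterMin
step afterMin    nextMinimum = afterNewMin
step _           _           = dead

accepting : Phase → ℕ → Bool
accepting afterNewMin c = false
accepting dead        c = false
accepting _           c = c ≡ᵇ 1

run : Phase → ℕ → ℕ → List ℕ → Bool
run ph k c []       = accepting ph c
run ph k c (z ∷ zs) =
  if z ≡ᵇ k then run (step ph maximum) k c zs
  else if z ≡ᵇ c then run (step ph minimum) k c zs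
  else if suc z ≡ᵇ c then run (step ph nextMinimum) k z zs
  else false

Consistent : Phase → ℕ → ℕ → Set
Consistent maxOnly k c = c ≡ k
Consistent dead    k c = ⊤
Consistent _       k c = c < k

-- What the last letter read still owes to Ascbot = Nub: a new minimum must be followed by an
-- ascent, a repeated letter must not be.
obligation : Phase → ℕ → ℕ → List ℕ → Bool
obligation maxOnly     k c zs = not (isAscentBottom k zs)
obligation afterNewMin k c zs = isAscentBottom c zs
obligation afterMax    k c zs = not (isAscentBottom k zs)
obligation afterMin    k c zs = not (isAscentBottom c zs)
obligation dead        k c zs = false

data LetterKind (k c z : ℕ) : Set where
  isMaximum     : z ≡ k → LetterKind k c z
  isMinimum     : z ≡ c → z ≢ k → LetterKind k c z
  isNextMinimum : suc z ≡ c → LetterKind k c z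
  isOther       : z ≢ k → z ≢ c → suc z ≢ c → LetterKind k c z

letterKind : ∀ k c z → LetterKind k c z
letterKind k c z with z ≟ k | z ≟ c | suc z ≟ c
... | yes z≡k | _       | _         = isMaximum z≡k
... | no z≢k  | yes z≡c | _         = isMinimum z≡c z≢k
... | no _    | no _    | yes 1+z≡c = isNextMinimum 1+z≡c
... | no z≢k  | no z≢c  | no 1+z≢c  = isOther z≢k z≢c 1+z≢c

module _ (ph : Phase) {k c : ℕ} (zs : List ℕ) where

  run-maximum : run ph k c (k ∷ zs) ≡ run (step ph maximum) k c zs
  run-maximum rewrite ≡ᵇ-refl k = refl

  run-minimum : c ≢ k → run ph k c (c ∷ zs) ≡ run (step ph minimum) k c zs
  run-minimum c≢k rewrite ≢⇒≡ᵇ≡false c≢k | ≡ᵇ-refl c = refl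

  run-nextMinimum : ∀ {z} → z < k → suc z ≡ c → run ph k c (z ∷ zs) ≡ run (step ph nextMinimum) k z zs
  run-nextMinimum {z} z<k refl rewrite ≢⇒≡ᵇ≡false (<⇒≢ z<k) | ≢⇒≡ᵇ≡false (<⇒≢ (n<1+n z)) | ≡ᵇ-refl z = refl

  run-other : ∀ {z} → z ≢ k → z ≢ c → suc z ≢ c → run ph k c (z ∷ zs) ≡ false
  run-other z≢k z≢c 1+z≢c rewrite ≢⇒≡ᵇ≡false z≢k | ≢⇒≡ᵇ≡false z≢c | ≢⇒≡ᵇ≡false 1+z≢c = refl

obligation-maximum : ∀ ph {k c} zs r → Consistent ph k c →
  obligation ph k c (k ∷ zs) ∧ (not (isAscentBottom k zs) ∧ r) ≡ obligation (step ph maximum) k c zs ∧ r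
obligation-maximum maxOnly     {k} zs r C rewrite ≥⇒<ᵇ≡false (≤-refl {k}) = refl
obligation-maximum afterNewMin     zs r C rewrite <⇒<ᵇ≡true C = refl
obligation-maximum afterMax    {k} zs r C rewrite ≥⇒<ᵇ≡false (≤-refl {k}) = refl
obligation-maximum afterMin        zs r C rewrite <⇒<ᵇ≡true C = refl
obligation-maximum dead            zs r C = refl

obligation-minimum : ∀ ph {k c} zs r → Consistent ph k c → c ≢ k →
  obligation ph k c (c ∷ zs) ∧ (not (isAscentBottom c zs) ∧ r) ≡ obligation (step ph minimum) k c zs ∧ r
obligation-minimum maxOnly         zs r C c≢k = contradiction C c≢k
obligation-minimum afterNewMin {c = c} zs r C _ rewrite ≥⇒<ᵇ≡false (≤-refl {c}) = refl
obligation-minimum afterMax        zs r C _ rewrite ≥⇒<ᵇ≡false (<⇒≤ C) = refl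
obligation-minimum afterMin    {c = c} zs r C _ rewrite ≥⇒<ᵇ≡false (≤-refl {c}) = refl
obligation-minimum dead            zs r C _ = refl

obligation-nextMinimum : ∀ ph {k c z} zs r → Consistent ph k c → suc z ≡ c →
  obligation ph k c (z ∷ zs) ∧ (isAscentBottom z zs ∧ r) ≡ obligation (step ph nextMinimum) k z zs ∧ r
obligation-nextMinimum maxOnly     {z = z} zs r C refl rewrite ≥⇒<ᵇ≡false (<⇒≤ (subst (z <_) C (n<1+n z))) = refl
obligation-nextMinimum afterNewMin {z = z} zs r C refl rewrite ≥⇒<ᵇ≡false (n≤1+n z) = refl
obligation-nextMinimum afterMax    {z = z} zs r C refl rewrite ≥⇒<ᵇ≡false (<⇒≤ (<-trans (n<1+n z) C)) = refl
obligation-nextMinimum afterMin    {z = z} zs r C refl rewrite ≥⇒<ᵇ≡false (n≤1+n z) = refl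
obligation-nextMinimum dead                zs r C refl = refl

scan-maximum : ∀ ph {pre k c} zs → Prefix pre k c → Consistent ph k c →
  obligation ph k c (k ∷ zs) ∧ validAfter pre (k ∷ zs)
  ≡ obligation (step ph maximum) k c zs ∧ validAfter (pre ++ [ k ]) zs
scan-maximum ph {k = k} {c} zs P C =
  trans (cong (obligation ph k c (k ∷ zs) ∧_) (validAfter-old zs P (inj₁ refl))) (obligation-maximum ph zs _ C)

scan-minimum : ∀ ph {pre k c} zs → Prefix pre k c → Consistent ph k c → c ≢ k →
  obligation ph k c (c ∷ zs) ∧ validAfter pre (c ∷ zs)
  ≡ obligation (step ph minimum) k c zs ∧ validAfter (pre ++ [ c ]) zs
scan-minimum ph {k = k} {c} zs P C c≢k =
  trans (cong (obligation ph k c (c ∷ zs) ∧_) (validAfter-old zs P (inj₂ refl)))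
        (obligation-minimum ph zs _ C c≢k)

scan-nextMinimum : ∀ ph {pre k c z} zs → Prefix pre k c → Consistent ph k c → suc z ≡ c →
  obligation ph k c (z ∷ zs) ∧ validAfter pre (z ∷ zs)
  ≡ obligation (step ph nextMinimum) k z zs ∧ validAfter (pre ++ [ z ]) zs
scan-nextMinimum ph {k = k} {c} {z} zs P C 1+z≡c =
  trans (cong (obligation ph k c (z ∷ zs) ∧_) (validAfter-newMin zs P 1+z≡c))
        (obligation-nextMinimum ph zs _ C 1+z≡c)

Consistent-maximum : ∀ ph {k c} → Consistent ph k c → Consistent (step ph maximum) k c
Consistent-maximum maxOnly     C = C
Consistent-maximum afterNewMin C = C
Consistent-maximum afterMax    C = C
Consistent-maximum afterMin    C = _
Consistent-maximum dead        C = _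

Consistent-minimum : ∀ ph {k c} → Consistent ph k c → Consistent (step ph minimum) k c
Consistent-minimum afterMax    C = C
Consistent-minimum afterMin    C = C
Consistent-minimum maxOnly     C = _
Consistent-minimum afterNewMin C = _
Consistent-minimum dead        C = _

Consistent-nextMinimum : ∀ ph {k c z} → z < k → Consistent ph k c → Consistent (step ph nextMinimum) k z
Consistent-nextMinimum maxOnly     z<k _ = z<k
Consistent-nextMinimum afterMax    z<k _ = z<k
Consistent-nextMinimum afterMin    z<k _ = z<k
Consistent-nextMinimum afterNewMin z<k _ = _
Consistent-nextMinimum dead        z<k _ = _

simulate : ∀ ph {pre k c} xs → Prefix pre k c → Consistent ph k c → All (1 ≤_) xs →
           obligation ph k c xs ∧ validAfter pre xs ≡ run ph k c xs
simulate maxOnly     [] P _ [] = isCayley-Prefix P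
simulate afterNewMin [] P _ [] = refl
simulate afterMax    [] P _ [] = isCayley-Prefix P
simulate afterMin    [] P _ [] = isCayley-Prefix P
simulate dead        [] P _ [] = refl
simulate ph {pre} {k} {c} (z ∷ zs) P C (1≤z ∷ 1≤zs) with letterKind k c z
... | isMaximum refl =
  trans (scan-maximum ph zs P C)
        (trans (simulate (step ph maximum) zs (Prefix-snoc-old P (inj₁ refl)) (Consistent-maximum ph C) 1≤zs)
               (sym (run-maximum ph zs)))
... | isMinimum refl c≢k =
  trans (scan-minimum ph zs P C c≢k)
        (trans (simulate (step ph minimum) zs (Prefix-snoc-old P (inj₂ refl)) (Consistent-minimum ph C) 1≤zs)
               (sym (run-minimum ph zs c≢k)))
... | isNextMinimum 1+z≡c =
  trans (scan-nextMinimum ph zs P C 1+z≡c)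
        (trans (simulate (step ph nextMinimum) zs (Prefix-snoc-newMin P 1≤z 1+z≡c) (Consistent-nextMinimum ph z<k C) 1≤zs)
               (sym (run-nextMinimum ph zs z<k 1+z≡c)))
  where z<k = <-≤-trans (subst (z <_) 1+z≡c (n<1+n z)) (c≤k P)
... | isOther z≢k z≢c 1+z≢c =
  trans (cong (obligation ph k c (z ∷ zs) ∧_) (validAfter-reject zs P 1≤z z≢k z≢c 1+z≢c))
        (trans (∧-zeroʳ _) (sym (run-other ph zs z≢k z≢c 1+z≢c)))

-- After the first letter v no ascent is owed, but an ascent v < x₂ would start a run of new maxima.
validAfter-[] : ∀ v xs → validAfter [ v ] xs ≡ obligation maxOnly v v xs ∧ validAfter [ v ] xs
validAfter-[] v []       = refl
validAfter-[] v (z ∷ zs) with v <ᵇ z in v<z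
... | false = refl
... | true  = validAfter-newMax [ v ] zs (subst (_< z) (sym (⊔-identityʳ v)) (<ᵇ≡true⇒< v<z))

revisedAvoiding312≡run : ∀ {v xs} → 1 ≤ v → All (1 ≤_) xs →
                         isRevisedAscent (v ∷ xs) ∧ avoids (v ∷ xs) p312 ≡ run maxOnly v v xs
revisedAvoiding312≡run {v} {xs} 1≤v 1≤xs =
  trans (revisedAvoiding312≡validAfter v xs)
        (trans (validAfter-[] v xs) (simulate maxOnly xs (Prefix-[] 1≤v) refl 1≤xs))

-- Counting

countᵇ : {A : Set} → (A → Bool) → List A → ℕ
countᵇ p xs = length (filterᵇ p xs)

module _ {A : Set} where

  countᵇ-++ : ∀ (p : A → Bool) xs ys → countᵇ p (xs ++ ys) ≡ countᵇ p xs + countᵇ p ys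
  countᵇ-++ p xs ys = trans (cong length (filter-++ (T? ∘ p) xs ys)) (length-++ (filterᵇ p xs))

  countᵇ-concatMap : ∀ (p : A → Bool) (f : ℕ → List A) vs →
                     countᵇ p (concatMap f vs) ≡ sum (map (λ v → countᵇ p (f v)) vs)
  countᵇ-concatMap p f []       = refl
  countᵇ-concatMap p f (v ∷ vs) =
    trans (countᵇ-++ p (f v) (concatMap f vs)) (cong (countᵇ p (f v) +_) (countᵇ-concatMap p f vs))

  countᵇ-map : ∀ (p : A → Bool) (f : A → A) xs → countᵇ p (map f xs) ≡ countᵇ (p ∘ f) xs
  countᵇ-map p f []       = refl
  countᵇ-map p f (x ∷ xs) with p (f x)
  ... | true  = cong suc (countᵇ-map p f xs)
  ... | false = countᵇ-map p f xs

  countᵇ-cong : ∀ {p q : A → Bool} {xs} → All (λ x → p x ≡ q x) xs → countᵇ p xs ≡ countᵇ q xs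
  countᵇ-cong []                         = refl
  countᵇ-cong {p} {q} {x ∷ xs} (px≡qx ∷ eqs) rewrite px≡qx with q x
  ... | true  = cong suc (countᵇ-cong eqs)
  ... | false = countᵇ-cong eqs

  countᵇ-false : ∀ xs → countᵇ {A = A} (λ _ → false) xs ≡ 0
  countᵇ-false []       = refl
  countᵇ-false (_ ∷ xs) = countᵇ-false xs

atNextMin : (ℕ → ℕ) → ℕ → ℕ
atNextMin f (suc (suc c)) = f (suc c)
atNextMin f _             = 0

#accepted : Phase → ℕ → ℕ → ℕ
#accepted ph c zero    = if accepting ph c then 1 else 0
#accepted ph c (suc l) = #accepted (step ph maximum) c l + #accepted (step ph minimum) c l
                         + atNextMin (λ c′ → #accepted (step ph nextMinimum) c′ l) c

#accepted-dead : ∀ c l → #accepted dead c l ≡ 0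
#accepted-dead c       zero    = refl
#accepted-dead c       (suc l) rewrite #accepted-dead c l = atNextMin-dead c
  where
  atNextMin-dead : ∀ c → atNextMin (λ c′ → #accepted dead c′ l) c ≡ 0
  atNextMin-dead (suc (suc c)) = #accepted-dead (suc c) l
  atNextMin-dead 0             = refl
  atNextMin-dead 1             = refl

#accepted-minimum : ∀ ph {k c} l → Consistent ph k c → c ≡ k → #accepted (step ph minimum) c l ≡ 0
#accepted-minimum maxOnly     l _   _   = #accepted-dead _ l
#accepted-minimum afterNewMin l _   _   = #accepted-dead _ l
#accepted-minimum afterMax    l c<k c≡k = contradiction c≡k (<⇒≢ c<k)
#accepted-minimum afterMin    l c<k c≡k = contradiction c≡k (<⇒≢ c<k)
#accepted-minimum dead        l _   _   = #accepted-dead _ l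

sum-map-+ : ∀ (f g : ℕ → ℕ) xs → sum (map (λ x → f x + g x) xs) ≡ sum (map f xs) + sum (map g xs)
sum-map-+ f g []       = refl
sum-map-+ f g (x ∷ xs) =
  trans (cong (f x + g x +_) (sum-map-+ f g xs)) (+-interchange (f x) (g x) (sum (map f xs)) (sum (map g xs)))

sum-map-zero : ∀ {f : ℕ → ℕ} → (∀ x → f x ≡ 0) → ∀ xs → sum (map f xs) ≡ 0
sum-map-zero f≗0 []       = refl
sum-map-zero f≗0 (x ∷ xs) = cong₂ _+_ (f≗0 x) (sum-map-zero f≗0 xs)

indicator : ℕ → (ℕ → ℕ) → ℕ → ℕ
indicator a f v = if v ≡ᵇ a then f v else 0

sum-indicator-below : ∀ a f j m → a < j → sum (map (indicator a f) (interval j m)) ≡ 0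
sum-indicator-below a f j zero    _   = refl
sum-indicator-below a f j (suc m) a<j
  rewrite ≢⇒≡ᵇ≡false (>⇒≢ a<j) = sum-indicator-below a f (suc j) m (<-trans a<j (n<1+n j))

sum-indicator : ∀ a f j m → j ≤ a → a < j + m → sum (map (indicator a f) (interval j m)) ≡ f a
sum-indicator a f j zero    j≤a a<j+0 = contradiction (subst (a <_) (+-identityʳ j) a<j+0) (≤⇒≯ j≤a)
sum-indicator a f j (suc m) j≤a a<j+m with m≤n⇒m<n∨m≡n j≤a
... | inj₁ j<a rewrite ≢⇒≡ᵇ≡false (<⇒≢ j<a) = sum-indicator a f (suc j) m j<a (subst (a <_) (+-suc j m) a<j+m)
... | inj₂ refl rewrite ≡ᵇ-refl a =
  trans (cong (f a +_) (sum-indicator-below a f (suc a) m (n<1+n a))) (+-identityʳ (f a))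

sum-nextMin-indicator : ∀ f c n → 1 ≤ c → c ≤ n →
  sum (map (λ v → if suc v ≡ᵇ c then f v else 0) (interval 1 n)) ≡ atNextMin f c
sum-nextMin-indicator f 1             n _ _   = sum-indicator-below 0 f 1 n z<s
sum-nextMin-indicator f (suc (suc c)) n _ c≤n = sum-indicator (suc c) f 1 n (s≤s z≤n) (s≤s (≤-trans (n≤1+n (suc c)) c≤n))

nextMin-vanishes : ∀ (f : ℕ → ℕ) {c v} → c ≤ v → (if suc v ≡ᵇ c then f v else 0) ≡ 0
nextMin-vanishes f {v = v} c≤v = cong (λ b → if b then f v else 0) (≢⇒≡ᵇ≡false (>⇒≢ (s≤s c≤v)))

-- The letters k, c and c - 1 are distinct, except in the phase maxOnly where c = k and the
-- branch for c is never taken.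
split-letters : ∀ {k c} A B (f : ℕ → ℕ) → c ≤ k → (c ≡ k → B ≡ 0) → ∀ v →
  (if v ≡ᵇ k then A else if v ≡ᵇ c then B else if suc v ≡ᵇ c then f v else 0)
  ≡ indicator k (λ _ → A) v + indicator c (λ _ → B) v + (if suc v ≡ᵇ c then f v else 0)
split-letters {k} {c} A B f c≤k c≡k⇒B≡0 v with v ≡ᵇ k in v≡k | v ≡ᵇ c in v≡c
... | true  | true  = sym (trans (cong₂ (λ x y → A + x + y) (c≡k⇒B≡0 (trans c≡v (≡ᵇ≡true⇒≡ v≡k)))
                                                        (nextMin-vanishes f (≤-reflexive c≡v)))
                                 (trans (+-identityʳ (A + 0)) (+-identityʳ A)))
  where
  c≡v : c ≡ v
  c≡v = sym (≡ᵇ≡true⇒≡ v≡c)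
... | true  | false = sym (trans (cong (A + 0 +_) (nextMin-vanishes f (≤-trans c≤k (≤-reflexive (sym (≡ᵇ≡true⇒≡ v≡k))))))
                                 (trans (+-identityʳ (A + 0)) (+-identityʳ A)))
... | false | true  = sym (trans (cong (B +_) (nextMin-vanishes f (≤-reflexive (sym (≡ᵇ≡true⇒≡ v≡c))))) (+-identityʳ B))
... | false | false = refl

sum-letters : ∀ n {k c} A B (f : ℕ → ℕ) → 1 ≤ c → c ≤ k → k ≤ n → (c ≡ k → B ≡ 0) →
  sum (map (λ v → if v ≡ᵇ k then A else if v ≡ᵇ c then B else if suc v ≡ᵇ c then f v else 0) (oneTo n))
  ≡ A + B + atNextMin f c
sum-letters n {k} {c} A B f 1≤c c≤k k≤n c≡k⇒B≡0 = begin
    sum (map branches (oneTo n))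
  ≡⟨ cong (sum ∘ map branches) (oneTo≡interval n) ⟩
    sum (map branches vs)
  ≡⟨ cong sum (map-cong (split-letters A B f c≤k c≡k⇒B≡0) vs) ⟩
    sum (map (λ v → atK v + atC v + atNextMinC v) vs)
  ≡⟨ sum-map-+ (λ v → atK v + atC v) atNextMinC vs ⟩
    sum (map (λ v → atK v + atC v) vs) + sum (map atNextMinC vs)
  ≡⟨ cong₂ _+_ (sum-map-+ atK atC vs) (sum-nextMin-indicator f c n 1≤c c≤n) ⟩
    sum (map atK vs) + sum (map atC vs) + atNextMin f c
  ≡⟨ cong₂ (λ x y → x + y + atNextMin f c) (sum-indicator k (λ _ → A) 1 n (≤-trans 1≤c c≤k) (s≤s k≤n))
                                           (sum-indicator c (λ _ → B) 1 n 1≤c (s≤s c≤n)) ⟩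
    A + B + atNextMin f c ∎
  where
  open ≡-Reasoning
  vs = interval 1 n
  c≤n = ≤-trans c≤k k≤n
  branches atK atC atNextMinC : ℕ → ℕ
  branches v = if v ≡ᵇ k then A else if v ≡ᵇ c then B else if suc v ≡ᵇ c then f v else 0
  atK = indicator k (λ _ → A)
  atC = indicator c (λ _ → B)
  atNextMinC v = if suc v ≡ᵇ c then f v else 0

oneTo-range : ∀ n → All (λ v → 1 ≤ v × v ≤ n) (oneTo n)
oneTo-range n = All.map⁺ (All.applyUpTo⁺₁ id n (λ i<n → s≤s z≤n , i<n))

count-run : ∀ n l ph {k c} → Consistent ph k c → 1 ≤ c → c ≤ k → k ≤ n →
            countᵇ (run ph k c) (wordsOver n l) ≡ #accepted ph c l
count-run n zero    ph {k} {c} _ _ _ _ with accepting ph c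
... | true  = refl
... | false = refl
count-run n (suc l) ph {k} {c} C 1≤c c≤k k≤n = begin
    countᵇ (run ph k c) (concatMap (λ v → map (v ∷_) (wordsOver n l)) (oneTo n))
  ≡⟨ countᵇ-concatMap (run ph k c) _ (oneTo n) ⟩
    sum (map (λ v → countᵇ (run ph k c) (map (v ∷_) (wordsOver n l))) (oneTo n))
  ≡⟨ cong sum (map-cong-local (All.map (λ (1≤v , _) → perLetter 1≤v) (oneTo-range n))) ⟩
    sum (map (λ v → if v ≡ᵇ k then A else if v ≡ᵇ c then B else if suc v ≡ᵇ c then nextMin v else 0) (oneTo n))
  ≡⟨ sum-letters n A B nextMin 1≤c c≤k k≤n (#accepted-minimum ph l C) ⟩
    #accepted ph c (suc l) ∎
  where
  open ≡-Reasoning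
  A = #accepted (step ph maximum) c l
  B = #accepted (step ph minimum) c l
  nextMin = λ v → #accepted (step ph nextMinimum) v l
  perLetter : ∀ {v} → 1 ≤ v → countᵇ (run ph k c) (map (v ∷_) (wordsOver n l))
              ≡ (if v ≡ᵇ k then A else if v ≡ᵇ c then B else if suc v ≡ᵇ c then nextMin v else 0)
  perLetter {v} 1≤v = trans (countᵇ-map (run ph k c) (v ∷_) (wordsOver n l)) byBranch
    where
    byBranch : countᵇ (λ zs → run ph k c (v ∷ zs)) (wordsOver n l)
               ≡ (if v ≡ᵇ k then A else if v ≡ᵇ c then B else if suc v ≡ᵇ c then nextMin v else 0)
    byBranch with v ≡ᵇ k | v ≡ᵇ c | suc v ≡ᵇ c in 1+v≡c
    ... | true  | _     | _     = count-run n l (step ph maximum) (Consistent-maximum ph C) 1≤c c≤k k≤n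
    ... | false | true  | _     = count-run n l (step ph minimum) (Consistent-minimum ph C) 1≤c c≤k k≤n
    ... | false | false | true  = count-run n l (step ph nextMinimum) (Consistent-nextMinimum ph v<k C) 1≤v (<⇒≤ v<k) k≤n
      where v<k = <-≤-trans (subst (v <_) (≡ᵇ≡true⇒≡ 1+v≡c) (n<1+n v)) c≤k
    ... | false | false | false = countᵇ-false (wordsOver n l)

Σ#accepted : Phase → ℕ → ℕ → ℕ
Σ#accepted ph N l = sum (map (λ c → #accepted ph c l) (interval 1 N))

Σ#accepted-dead : ∀ N l → Σ#accepted dead N l ≡ 0
Σ#accepted-dead N l = sum-map-zero (λ c → #accepted-dead c l) (interval 1 N)

sum-atNextMin : ∀ f N → sum (map (atNextMin f) (interval 1 (suc N))) ≡ sum (map f (interval 1 N))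
sum-atNextMin f N = shifted N 0
  where
  shifted : ∀ N j → sum (map (atNextMin f) (interval (2 + j) N)) ≡ sum (map f (interval (suc j) N))
  shifted zero    j = refl
  shifted (suc N) j = cong (f (suc j) +_) (shifted N (suc j))

Σ#accepted-suc : ∀ ph N l → Σ#accepted ph (suc N) (suc l)
  ≡ Σ#accepted (step ph maximum) (suc N) l + Σ#accepted (step ph minimum) (suc N) l
    + Σ#accepted (step ph nextMinimum) N l
Σ#accepted-suc ph N l =
  trans (sum-map-+ (λ c → max c + min c) (atNextMin next) cs)
        (cong₂ _+_ (sum-map-+ max min cs) (sum-atNextMin next N))
  where
  cs = interval 1 (suc N)
  max = λ c → #accepted (step ph maximum) c l
  min = λ c → #accepted (step ph minimum) c l
  next = λ c → #accepted (step ph nextMinimum) c l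

⌈2^_/2⌉ ⌊2^_/2⌋ : ℕ → ℕ
⌈2^ zero  /2⌉ = 1
⌈2^ suc l /2⌉ = 2 ^ l
⌊2^ zero  /2⌋ = 0
⌊2^ suc l /2⌋ = 2 ^ l

⌈2^/2⌉+⌊2^/2⌋ : ∀ l → ⌈2^ l /2⌉ + ⌊2^ l /2⌋ ≡ 2 ^ l
⌈2^/2⌉+⌊2^/2⌋ zero    = refl
⌈2^/2⌉+⌊2^/2⌋ (suc l) = cong (2 ^ l +_) (sym (+-identityʳ (2 ^ l)))

-- With l < N the sum reaches every minimum c ≤ l + 1, the only ones from which a word of length l
-- can still be accepted.
Σ#accepted-closed : ∀ l N → l < N →
  Σ#accepted maxOnly N l ≡ ⌈2^ l /2⌉ × Σ#accepted afterNewMin N l ≡ ⌊2^ l /2⌋ ×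
  Σ#accepted afterMax N l ≡ 2 ^ l × Σ#accepted afterMin N l ≡ ⌈2^ l /2⌉
Σ#accepted-closed zero (suc N) _ = only1 , sum-map-zero (λ _ → refl) (interval 1 (suc N)) , only1 , only1
  where
  only1 : sum (map (indicator 1 (λ _ → 1)) (interval 1 (suc N))) ≡ 1
  only1 = sum-indicator 1 (λ _ → 1) 1 (suc N) ≤-refl (s≤s (s≤s z≤n))
Σ#accepted-closed (suc l) (suc N) (s≤s l<N)
  with Σ#accepted-closed l (suc N) (m<n⇒m<1+n l<N) | Σ#accepted-closed l N l<N
... | mo , _ , am , an | _ , nm , _ , _
  rewrite Σ#accepted-suc maxOnly N l | Σ#accepted-suc afterNewMin N l
        | Σ#accepted-suc afterMax N l | Σ#accepted-suc afterMin N l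
        | Σ#accepted-dead (suc N) l | Σ#accepted-dead N l | mo | nm | am | an
  = trans (cong (_+ ⌊2^ l /2⌋) (+-identityʳ ⌈2^ l /2⌉)) (⌈2^/2⌉+⌊2^/2⌋ l)
  , trans (+-identityʳ (2 ^ l + 0)) (+-identityʳ (2 ^ l))
  , trans (+-assoc (2 ^ l) ⌈2^ l /2⌉ ⌊2^ l /2⌋)
          (trans (cong (2 ^ l +_) (⌈2^/2⌉+⌊2^/2⌋ l)) (cong (2 ^ l +_) (sym (+-identityʳ (2 ^ l)))))
  , ⌈2^/2⌉+⌊2^/2⌋ l

wordsOver-positive : ∀ n m → All (All (1 ≤_)) (wordsOver n m)
wordsOver-positive n zero    = [] ∷ []
wordsOver-positive n (suc m) =
  All.concat⁺ (All.map⁺ (All.map (λ (1≤v , _) → All.map⁺ (All.map (1≤v ∷_) (wordsOver-positive n m)))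
                                 (oneTo-range n)))

count-revisedAvoiding312-∷ : ∀ n l {v} → 1 ≤ v → v ≤ n →
  countᵇ (λ x → isRevisedAscent x ∧ avoids x p312) (map (v ∷_) (wordsOver n l)) ≡ #accepted maxOnly v l
count-revisedAvoiding312-∷ n l {v} 1≤v v≤n =
  trans (countᵇ-map (λ x → isRevisedAscent x ∧ avoids x p312) (v ∷_) (wordsOver n l))
        (trans (countᵇ-cong (All.map (revisedAvoiding312≡run 1≤v) (wordsOver-positive n l)))
               (count-run n l maxOnly refl 1≤v ≤-refl v≤n))

mainTheorem3 : (n : ℕ) → 2 ≤ n → length (hatB n p312) ≡ 2 ^ (n ∸ 2)
mainTheorem3 1 (s≤s ())
mainTheorem3 (suc (suc m)) _ = begin
    length (hatB n p312)
  ≡⟨ countᵇ-concatMap P (λ v → map (v ∷_) (wordsOver n (suc m))) (oneTo n) ⟩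
    sum (map (λ v → countᵇ P (map (v ∷_) (wordsOver n (suc m)))) (oneTo n))
  ≡⟨ cong sum (map-cong-local
       (All.map (λ (1≤v , v≤n) → count-revisedAvoiding312-∷ n (suc m) 1≤v v≤n) (oneTo-range n))) ⟩
    sum (map (λ v → #accepted maxOnly v (suc m)) (oneTo n))
  ≡⟨ cong (sum ∘ map (λ v → #accepted maxOnly v (suc m))) (oneTo≡interval n) ⟩
    Σ#accepted maxOnly n (suc m)
  ≡⟨ proj₁ (Σ#accepted-closed (suc m) n ≤-refl) ⟩
    2 ^ m ∎
  where
  open ≡-Reasoning
  n = suc (suc m)
  P = λ x → isRevisedAscent x ∧ avoids x p312
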